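{- Let $G$ be a connected simple graph satisfying condition $\star$: for every pair $a,b$ of distinct nonadjacent vertices there exists a vertex $c$ with $N(a)\cup N(b)\subseteq\overline{N(c)}$. Then the core of $G$ is a union of quadrilaterals and triangles.
   Context: For a vertex $a$, $N(a)$ is the set of vertices adjacent to $a$ and $\overline{N(a)}=N(a)\cup\{a\}$. The core of a graph is the subgraph consisting of the vertices and edges lying on cycles of the graph; "a union of quadrilaterals and triangles" means it is the union of cycles of length $4$ and $3$ of $G$. -}

module Defs where

open import Data.Nat using (ℕ; zero; suc; _+_)
open import Data.Fin using (Fin; zero; suc)
open import Data.Bool using (Bool; T)
open import Data.Empty using (⊥)
open import Data.Product using (Σ; ∃; _×_; _,_)
open import Data.Sum using (_⊎_)
open import Relation.Nullary using (¬_)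
open import Relation.Binary.PropositionalEquality using (_≡_; _≢_)
open import Function.Definitions using (Injective)

record SimpleGraph (n : ℕ) : Set where
  field
    adj      : Fin n → Fin n → Bool
    symmetric  : ∀ a b → T (adj a b) → T (adj b a)
    irreflexive : ∀ a → ¬ T (adj a a)

module _ {n : ℕ} (G : SimpleGraph n) where
  open SimpleGraph G

  Adj : Fin n → Fin n → Set
  Adj a b = T (adj a b)

  data Walk : Fin n → Fin n → Set where
    nil  : ∀ {a} → Walk a a
    cons : ∀ {a b c} → Adj a b → Walk b c → Walk a c

  Connected : Set
  Connected = ∀ a b → Walk a b

  InClosedNbhd : Fin n → Fin n → Set
  InClosedNbhd c x = x ≡ c ⊎ Adj c x

  Star : Set
  Star = ∀ a b → a ≢ b → ¬ Adj a b →
         ∃ λ c → ∀ x → (Adj a x ⊎ Adj b x) → InClosedNbhd c x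

-- cyclic successor on Fin (suc k): i ↦ i+1 mod (k+1)
next : ∀ {k} → Fin (suc k) → Fin (suc k)
next {zero} zero = zero
next {suc k} zero = suc zero
next {suc k} (suc i) with next {k} i
... | zero = zero
... | suc j = suc (suc j)

module _ {n : ℕ} (G : SimpleGraph n) where

  record Cycle : Set where
    field
      m      : ℕ
      vert   : Fin (3 + m) → Fin n
      inj    : Injective _≡_ _≡_ vert
      adjc   : ∀ i → Adj G (vert i) (vert (next i))

  len : Cycle → ℕ
  len C = 3 + Cycle.m C

  VertexOn : Cycle → Fin n → Set
  VertexOn C v = ∃ λ i → Cycle.vert C i ≡ v

  EdgeOn : Cycle → Fin n → Fin n → Set
  EdgeOn C u v = ∃ λ i →
      (Cycle.vert C i ≡ u × Cycle.vert C (next i) ≡ v)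
    ⊎ (Cycle.vert C i ≡ v × Cycle.vert C (next i) ≡ u)

  -- the core: vertices and edges lying on (some) cycle of G
  CoreVertex : Fin n → Set
  CoreVertex v = ∃ λ (C : Cycle) → VertexOn C v

  CoreEdge : Fin n → Fin n → Set
  CoreEdge u v = ∃ λ (C : Cycle) → EdgeOn C u v

  ShortCycle : Cycle → Set
  ShortCycle C = len C ≡ 3 ⊎ len C ≡ 4

  UnionVertex : Fin n → Set
  UnionVertex v = ∃ λ (C : Cycle) → ShortCycle C × VertexOn C v

  UnionEdge : Fin n → Fin n → Set
  UnionEdge u v = ∃ λ (C : Cycle) → ShortCycle C × EdgeOn C u v

  CoreIsUnionOfC3C4 : Set
  CoreIsUnionOfC3C4 =
      (∀ v → (CoreVertex v → UnionVertex v) × (UnionVertex v → CoreVertex v))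
    × (∀ u v → (CoreEdge u v → UnionEdge u v) × (UnionEdge u v → CoreEdge u v))

-- Every edge uv of a cycle … w u v v₂ v₃ … lies on a triangle or a quadrilateral.
-- If u ∼ v₂ or v ∼ w there is a triangle. Otherwise ⋆ applied to the nonadjacent
-- pair u, v₂ yields c whose closed neighbourhood contains v and w; as v ≁ w, c is
-- adjacent to both. If c ≠ u then u v c w is a quadrilateral; if c = u then v₃ ∈ N(v₂)
-- forces u ∼ v₃, and u v v₂ v₃ is a quadrilateral.
module Submission where

open import Defs
open import Data.Nat using (ℕ; zero; suc; _+_)
open import Data.Nat.Properties using (m≢1+n+m)
open import Data.Fin using (Fin; zero; suc; toℕ; fromℕ; inject₁; _≟_)
open import Data.Bool.Properties using (T?)
open import Data.Empty using (⊥-elim)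
open import Data.Product using (Σ; ∃; _×_; _,_)
open import Data.Sum using (_⊎_; inj₁; inj₂)
open import Relation.Nullary using (¬_; yes; no)
open import Relation.Binary.PropositionalEquality

toℕ-next : ∀ {k} (i : Fin (suc k)) →
           toℕ (next i) ≡ suc (toℕ i) ⊎ (next i ≡ zero × toℕ i ≡ k)
toℕ-next {zero}  zero    = inj₂ (refl , refl)
toℕ-next {suc k} zero    = inj₁ refl
toℕ-next {suc k} (suc i) with next i | toℕ-next i
... | zero  | inj₂ (_ , i≡k) = inj₂ (refl , cong suc i≡k)
... | suc j | inj₁ e         = inj₁ (cong suc e)

-- A fixed point of next ∘ next would force the cycle length 3 + m to be at most 2.
next-next-≢ : ∀ {m} (i : Fin (3 + m)) → next (next i) ≢ i
next-next-≢ i e with toℕ-next i | toℕ-next (next i)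
... | inj₁ t₁ | inj₁ t₂ = m≢1+n+m (toℕ i) {1} (trans (sym (cong toℕ e)) (trans t₂ (cong suc t₁)))
... | inj₁ t₁ | inj₂ (z , tn) with trans (sym e) z
...   | refl with trans (sym t₁) tn
...     | ()
next-next-≢ i e | inj₂ (z , ti) | _ with trans (cong toℕ (subst (λ x → next x ≡ i) z e)) ti
...   | ()

next-fromℕ : ∀ k → next (fromℕ k) ≡ zero
next-fromℕ zero = refl
next-fromℕ (suc k) rewrite next-fromℕ k = refl

next-inject₁ : ∀ {k} (i : Fin (suc k)) → next (inject₁ i) ≡ suc i
next-inject₁ zero = refl
next-inject₁ {suc k} (suc i) rewrite next-inject₁ i = refl

next-surjective : ∀ {k} (i : Fin (suc k)) → ∃ λ j → next j ≡ i
next-surjective {k}     zero    = fromℕ k , next-fromℕ k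
next-surjective {suc k} (suc i) = inject₁ i , next-inject₁ i

module _ {n : ℕ} (G : SimpleGraph n) where
  open SimpleGraph G

  private
    _∼_ : Fin n → Fin n → Set
    _∼_ = Adj G

  Adj-sym : ∀ {a b} → a ∼ b → b ∼ a
  Adj-sym = symmetric _ _

  Adj⇒≢ : ∀ {a b} → a ∼ b → a ≢ b
  Adj⇒≢ {a} a∼a refl = irreflexive a a∼a

  Adj⇒≢ˡ : ∀ {a b} → a ∼ b → b ≢ a
  Adj⇒≢ˡ a∼b e = Adj⇒≢ a∼b (sym e)

  closedNbhd-nonadjacent⇒Adj : ∀ {c x y} → InClosedNbhd G c x → InClosedNbhd G c y →
                                x ≢ y → ¬ x ∼ y → c ∼ x × c ∼ y
  closedNbhd-nonadjacent⇒Adj (inj₁ refl) (inj₁ refl) x≢y _   = ⊥-elim (x≢y refl)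
  closedNbhd-nonadjacent⇒Adj (inj₁ refl) (inj₂ c∼y)  _   x≁y = ⊥-elim (x≁y c∼y)
  closedNbhd-nonadjacent⇒Adj (inj₂ c∼x)  (inj₁ refl) _   x≁y = ⊥-elim (x≁y (Adj-sym c∼x))
  closedNbhd-nonadjacent⇒Adj (inj₂ c∼x)  (inj₂ c∼y)  _   _   = c∼x , c∼y

  ShortCycleThrough : Fin n → Fin n → Set
  ShortCycleThrough x y =
    Σ (Cycle G) λ D → ShortCycle G D × Cycle.vert D zero ≡ x × Cycle.vert D (suc zero) ≡ y

  triangle : ∀ {x y z} → x ∼ y → y ∼ z → z ∼ x → ShortCycleThrough x y
  triangle {x} {y} {z} p q r =
    record { m = 0 ; vert = v ; inj = v-injective ; adjc = v-adj } , inj₁ refl , refl , refl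
    where
    v : Fin 3 → Fin n
    v zero             = x
    v (suc zero)       = y
    v (suc (suc zero)) = z
    v-injective : ∀ {a b} → v a ≡ v b → a ≡ b
    v-injective {zero}             {zero}             _ = refl
    v-injective {zero}             {suc zero}         e = ⊥-elim (Adj⇒≢ p e)
    v-injective {zero}             {suc (suc zero)}   e = ⊥-elim (Adj⇒≢ˡ r e)
    v-injective {suc zero}         {zero}             e = ⊥-elim (Adj⇒≢ˡ p e)
    v-injective {suc zero}         {suc zero}         _ = refl
    v-injective {suc zero}         {suc (suc zero)}   e = ⊥-elim (Adj⇒≢ q e)
    v-injective {suc (suc zero)}   {zero}             e = ⊥-elim (Adj⇒≢ r e)
    v-injective {suc (suc zero)}   {suc zero}         e = ⊥-elim (Adj⇒≢ˡ q e)
    v-injective {suc (suc zero)}   {suc (suc zero)}   _ = refl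
    v-adj : ∀ i → v i ∼ v (next i)
    v-adj zero             = p
    v-adj (suc zero)       = q
    v-adj (suc (suc zero)) = r

  quadrilateral : ∀ {x y z t} → x ∼ y → y ∼ z → z ∼ t → t ∼ x → x ≢ z → y ≢ t →
                  ShortCycleThrough x y
  quadrilateral {x} {y} {z} {t} p q r s x≢z y≢t =
    record { m = 1 ; vert = v ; inj = v-injective ; adjc = v-adj } , inj₂ refl , refl , refl
    where
    v : Fin 4 → Fin n
    v zero                   = x
    v (suc zero)             = y
    v (suc (suc zero))       = z
    v (suc (suc (suc zero))) = t
    v-injective : ∀ {a b} → v a ≡ v b → a ≡ b
    v-injective {zero}                   {zero}                   _ = refl
    v-injective {zero}                   {suc zero}               e = ⊥-elim (Adj⇒≢ p e)
    v-injective {zero}                   {suc (suc zero)}         e = ⊥-elim (x≢z e)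
    v-injective {zero}                   {suc (suc (suc zero))}   e = ⊥-elim (Adj⇒≢ˡ s e)
    v-injective {suc zero}               {zero}                   e = ⊥-elim (Adj⇒≢ˡ p e)
    v-injective {suc zero}               {suc zero}               _ = refl
    v-injective {suc zero}               {suc (suc zero)}         e = ⊥-elim (Adj⇒≢ q e)
    v-injective {suc zero}               {suc (suc (suc zero))}   e = ⊥-elim (y≢t e)
    v-injective {suc (suc zero)}         {zero}                   e = ⊥-elim (x≢z (sym e))
    v-injective {suc (suc zero)}         {suc zero}               e = ⊥-elim (Adj⇒≢ˡ q e)
    v-injective {suc (suc zero)}         {suc (suc zero)}         _ = refl
    v-injective {suc (suc zero)}         {suc (suc (suc zero))}   e = ⊥-elim (Adj⇒≢ r e)
    v-injective {suc (suc (suc zero))}   {zero}                   e = ⊥-elim (Adj⇒≢ s e)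
    v-injective {suc (suc (suc zero))}   {suc zero}               e = ⊥-elim (y≢t (sym e))
    v-injective {suc (suc (suc zero))}   {suc (suc zero)}         e = ⊥-elim (Adj⇒≢ˡ r e)
    v-injective {suc (suc (suc zero))}   {suc (suc (suc zero))}   _ = refl
    v-adj : ∀ i → v i ∼ v (next i)
    v-adj zero                   = p
    v-adj (suc zero)             = q
    v-adj (suc (suc zero))       = r
    v-adj (suc (suc (suc zero))) = s

  star⇒quadrilateral : Star G → ∀ {w u v v₂ v₃} →
    w ∼ u → u ∼ v → v ∼ v₂ → v₂ ∼ v₃ → w ≢ v → u ≢ v₂ → v ≢ v₃ →
    ¬ u ∼ v₂ → ¬ v ∼ w → ShortCycleThrough u v
  star⇒quadrilateral star {w} {u} {v} {v₂} {v₃} w∼u u∼v v∼v₂ v₂∼v₃ w≢v u≢v₂ v≢v₃ u≁v₂ v≁w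
    with star u v₂ u≢v₂ u≁v₂
  ... | c , N[u]∪N[v₂]⊆N̄[c]
    with closedNbhd-nonadjacent⇒Adj (N[u]∪N[v₂]⊆N̄[c] v (inj₁ u∼v))
                                   (N[u]∪N[v₂]⊆N̄[c] w (inj₁ (Adj-sym w∼u)))
                                   (λ e → w≢v (sym e)) v≁w
  ...   | c∼v , c∼w with c ≟ u
  ...     | no c≢u = quadrilateral u∼v (Adj-sym c∼v) c∼w w∼u (λ e → c≢u (sym e)) (λ e → w≢v (sym e))
  ...     | yes refl with N[u]∪N[v₂]⊆N̄[c] v₃ (inj₂ v₂∼v₃)
  ...       | inj₁ refl = ⊥-elim (u≁v₂ (Adj-sym v₂∼v₃))
  ...       | inj₂ u∼v₃ = quadrilateral u∼v v∼v₂ v₂∼v₃ (Adj-sym u∼v₃) u≢v₂ v≢v₃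

  cycleEdge⇒shortCycleThrough : Star G → (C : Cycle G) (i : Fin (len G C)) →
    ShortCycleThrough (Cycle.vert C i) (Cycle.vert C (next i))
  cycleEdge⇒shortCycleThrough star C i with next-surjective i
  ... | j , next-j≡i = edge
    where
    open Cycle C
    w∼u : vert j ∼ vert i
    w∼u = subst (λ k → vert j ∼ vert k) next-j≡i (adjc j)
    w≢v : vert j ≢ vert (next i)
    w≢v e = next-next-≢ j (trans (cong next next-j≡i) (sym (inj e)))
    u≢v₂ : vert i ≢ vert (next (next i))
    u≢v₂ e = next-next-≢ i (sym (inj e))
    v≢v₃ : vert (next i) ≢ vert (next (next (next i)))
    v≢v₃ e = next-next-≢ (next i) (sym (inj e))
    edge : ShortCycleThrough (vert i) (vert (next i))
    edge with T? (adj (vert i) (vert (next (next i)))) | T? (adj (vert (next i)) (vert j))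
    ... | yes u∼v₂ | _       = triangle (adjc i) (adjc (next i)) (Adj-sym u∼v₂)
    ... | no _     | yes v∼w = triangle (adjc i) v∼w w∼u
    ... | no u≁v₂  | no v≁w  = star⇒quadrilateral star w∼u (adjc i) (adjc (next i))
                                 (adjc (next (next i))) w≢v u≢v₂ v≢v₃ u≁v₂ v≁w

mainTheorem5 : (n : ℕ) (G : SimpleGraph n) → Connected G → Star G → CoreIsUnionOfC3C4 G
mainTheorem5 n G _ star =
  (λ x → coreVertex⇒union x , λ { (C , _ , x∈C) → C , x∈C }) ,
  (λ x y → coreEdge⇒union x y , λ { (C , _ , xy∈C) → C , xy∈C })
  where
  coreVertex⇒union : ∀ x → CoreVertex G x → UnionVertex G x
  coreVertex⇒union x (C , i , vᵢ≡x) with cycleEdge⇒shortCycleThrough G star C i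
  ... | D , short , d₀≡vᵢ , _ = D , short , zero , trans d₀≡vᵢ vᵢ≡x
  coreEdge⇒union : ∀ x y → CoreEdge G x y → UnionEdge G x y
  coreEdge⇒union x y (C , i , xy∈C) with cycleEdge⇒shortCycleThrough G star C i | xy∈C
  ... | D , short , d₀ , d₁ | inj₁ (e₀ , e₁) = D , short , zero , inj₁ (trans d₀ e₀ , trans d₁ e₁)
  ... | D , short , d₀ , d₁ | inj₂ (e₀ , e₁) = D , short , zero , inj₂ (trans d₀ e₀ , trans d₁ e₁)
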